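{- Let $p_1,\ldots,p_k$ be distinct odd primes and $l_1,\ldots,l_k$ positive integers such that each $p_i^{l_i}$ is an overpseudoprime to base 2 and $h(p_1)=h(p_2)=\cdots=h(p_k)$. Then $n=p_1^{l_1}\cdots p_k^{l_k}$ is an overpseudoprime to base 2.
   Context: For an odd integer $m>1$, $h(m)$ denotes the multiplicative order of 2 modulo $m$. The cyclotomic cosets of 2 modulo $m$ are the orbits of $\{1,2,\ldots,m-1\}$ under $x\mapsto 2x \bmod m$; $r(m)$ is their number. An odd composite number $n$ is called an overpseudoprime to base 2 if $n=r(n)h(n)+1$. -}

module Defs where

open import Data.Nat using (ℕ; zero; suc; _+_; _*_; _∸_; _^_; _≤_; _<_; _≤?_)
open import Data.Nat.DivMod using (_%_)
open import Data.Nat.Divisibility using (_∣_; _∣?_)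
open import Data.Nat.Primality using (Composite)
open import Data.Fin using (Fin; zero; suc)
open import Data.Bool using (Bool; true; false; _∧_)
open import Relation.Nullary using (¬_; does)
open import Relation.Binary.PropositionalEquality using (_≡_)

_mod_ : ℕ → ℕ → ℕ
a mod zero = a
a mod suc m = a % suc m

private
  searchOrd : ℕ → ℕ → ℕ → ℕ
  searchOrd m zero d = 0
  searchOrd m (suc fuel) d with m ∣? (2 ^ d ∸ 1)
  ... | Relation.Nullary.yes _ = d
  ... | Relation.Nullary.no  _ = searchOrd m fuel (suc d)

-- h m : multiplicative order of 2 modulo m, i.e. the least d ≥ 1 with
-- 2^d ≡ 1 (mod m).  For odd m > 1 it exists and is < m, so searching
-- d = 1, …, m finds it.
h : ℕ → ℕ
h m = searchOrd m m 1

-- x is the least element of its cyclotomic coset {x·2^j mod m : j ≥ 0}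
-- (the coset is {x·2^j mod m : j < h m} since 2^(h m) ≡ 1 mod m)
private
  allBelow : ℕ → (ℕ → Bool) → Bool
  allBelow zero P = true
  allBelow (suc j) P = allBelow j P ∧ P j

  countIn : ℕ → (ℕ → Bool) → ℕ
  countIn zero P = 0
  countIn (suc n) P with P (suc n)
  ... | true  = suc (countIn n P)
  ... | false = countIn n P

isCosetLeader : ℕ → ℕ → Bool
isCosetLeader m x = allBelow (h m) (λ j → does (x ≤? ((x * 2 ^ j) mod m)))

-- r m : number of cyclotomic cosets of 2 modulo m on {1,…,m-1},
-- counted via their (unique) least elements.
r : ℕ → ℕ
r m = countIn (m ∸ 1) (isCosetLeader m)

Overpseudoprime2 : ℕ → Set
Overpseudoprime2 n = ¬ (2 ∣ n) × Composite n × (n ≡ r n * h n + 1)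
  where open import Data.Product using (_×_)

∏ : (k : ℕ) → (Fin k → ℕ) → ℕ
∏ zero f = 1
∏ (suc k) f = f zero * ∏ k (λ i → f (suc i))

{-# OPTIONS --safe #-}

-- Let m be odd with D = h m.  Every cyclotomic coset of 2 modulo m has at
-- most D elements, and exactly D unless some x is fixed by 2^t for some
-- 0 < t < D.  Coding x by the rank of its coset's least element and its shift
-- from it gives m - 1 ≤ r(m) D, strictly if some coset is short, with equality
-- when all cosets are full.
-- For an overpseudoprime p^l, the element p^(l-1) is fixed by 2^(h p), so its
-- coset is short unless h(p^l) = h(p); hence p^l ∣ 2^H - 1 with H = h p.
-- For n = ∏ pᵢ^lᵢ with common H this gives n ∣ 2^H - 1 and h n = H.  If
-- x 2^t ≡ x (mod n) with 0 < t < H, then pᵢ ∤ 2^t - 1 forces pᵢ^lᵢ ∣ x for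
-- every i, so n ∣ x; thus all cosets modulo n are full and n - 1 = r(n) h(n).

module Submission where

open import Defs
open import Data.Bool using (Bool; true; false)
open import Data.Fin using (Fin; zero; suc; toℕ; fromℕ<)
open import Data.Fin.Properties using (injective⇒≤; toℕ-fromℕ<; toℕ-injective; toℕ<n)
import Data.Fin.Properties as Fin
open import Data.Nat
open import Data.Nat.Properties
open import Data.Nat.DivMod hiding (_mod_)
open import Data.Nat.Divisibility
open import Data.Nat.Coprimality using (Coprime; coprime-divisor)
open import Data.Nat.Primality
  using (Prime; Composite; prime[2]; ¬prime[1]; prime⇒irreducible; prime⇒nonTrivial; prime⇒nonZero;
         euclidsLemma; composite⇒nonTrivial; composite-∣)
open import Data.Product using (_×_; _,_; proj₁; proj₂)
open import Data.Sum using (inj₁; inj₂)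
open import Function using (_∘_)
open import Function.Definitions using (Injective)
open import Relation.Nullary using (¬_; Dec; yes; no; does; contradiction)
open import Relation.Nullary.Decidable using (dec-true)
open import Relation.Binary.Definitions using (tri<; tri≈; tri>)
open import Relation.Binary.PropositionalEquality

-- Defs keeps searchOrd, countIn and allBelow private.  They are recovered as
-- metavariables solved by the probes below: each probe unfolds h, r or
-- isCosetLeader and abstracts the arguments of the helper into variables, so
-- that unification sees a pattern.
mutual
  searchOrd : ℕ → ℕ → ℕ → ℕ
  searchOrd = _

  countIn : ℕ → (ℕ → Bool) → ℕ
  countIn = _

  allBelow : ℕ → (ℕ → Bool) → Bool
  allBelow = _

  private
    searchOrd-probe : ∀ m → h m ≡ h m
    searchOrd-probe zero = refl
    searchOrd-probe (suc m) with suc m ∣? (2 ^ 1 ∸ 1)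
    ... | yes _ = refl
    ... | no _ with suc m | 2
    ... | M | d = refl {x = searchOrd M m d}

    countIn-probe : ∀ m → r m ≡ r m
    countIn-probe m with m ∸ 1 | isCosetLeader m
    ... | n | P = refl {x = countIn n P}

    allBelow-probe : ∀ m x → isCosetLeader m x ≡ isCosetLeader m x
    allBelow-probe m x with h m | (λ j → does (x ≤? ((x * 2 ^ j) mod m)))
    ... | n | P = refl {x = allBelow n P}

Period : ℕ → ℕ → Set
Period m d = m ∣ 2 ^ d ∸ 1

record LeastPeriodFrom (m s e : ℕ) : Set where
  field
    from   : s ≤ e
    period : Period m e
    least  : ∀ d → s ≤ d → d < e → ¬ Period m d

IsOrder : ℕ → ℕ → Set
IsOrder m = LeastPeriodFrom m 1

searchOrd-finds : ∀ m fuel s e → LeastPeriodFrom m s e → e < s + fuel →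
                  searchOrd m fuel s ≡ e
searchOrd-finds m zero s e lp e< =
  contradiction (≤-trans (≤-reflexive (+-identityʳ s)) (LeastPeriodFrom.from lp)) (<⇒≱ e<)
searchOrd-finds m (suc fuel) s e lp e< with m ∣? (2 ^ s ∸ 1)
... | yes ps with m≤n⇒m<n∨m≡n (LeastPeriodFrom.from lp)
...   | inj₁ s<e = contradiction ps (LeastPeriodFrom.least lp s ≤-refl s<e)
...   | inj₂ s≡e = s≡e
searchOrd-finds m (suc fuel) s e lp e< | no ¬ps = searchOrd-finds m fuel (suc s) e lp′ e<′
  where
  open LeastPeriodFrom lp
  from′ : suc s ≤ e
  from′ with m≤n⇒m<n∨m≡n from
  ... | inj₁ s<e = s<e
  ... | inj₂ refl = contradiction period ¬ps
  lp′ : LeastPeriodFrom m (suc s) e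
  lp′ = record { from = from′ ; period = period ; least = λ d s<d → least d (<⇒≤ s<d) }
  e<′ : e < suc s + fuel
  e<′ = subst (e <_) (+-suc s fuel) e<

searchOrd-sound : ∀ m fuel s → searchOrd m fuel s ≢ 0 →
                  LeastPeriodFrom m s (searchOrd m fuel s)
searchOrd-sound m zero s nonzero = contradiction refl nonzero
searchOrd-sound m (suc fuel) s nonzero with m ∣? (2 ^ s ∸ 1)
... | yes ps =
  record { from = ≤-refl ; period = ps ; least = λ d s≤d d<s → contradiction s≤d (<⇒≱ d<s) }
... | no ¬ps = record { from = <⇒≤ from ; period = period ; least = least′ }
  where
  open LeastPeriodFrom (searchOrd-sound m fuel (suc s) nonzero)
  least′ : ∀ d → s ≤ d → d < searchOrd m fuel (suc s) → ¬ Period m d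
  least′ d s≤d with m≤n⇒m<n∨m≡n s≤d
  ... | inj₁ s<d = least d s<d
  ... | inj₂ refl = λ _ → ¬ps

searchOrd≢0 : ∀ m fuel s d → 1 ≤ s → s ≤ d → d < s + fuel → Period m d →
              searchOrd m fuel s ≢ 0
searchOrd≢0 m zero s d 1≤s s≤d d< per =
  contradiction (≤-trans (≤-reflexive (+-identityʳ s)) s≤d) (<⇒≱ d<)
searchOrd≢0 m (suc fuel) s d 1≤s s≤d d< per with m ∣? (2 ^ s ∸ 1)
... | yes _ = λ s≡0 → contradiction (subst (1 ≤_) s≡0 1≤s) λ ()
... | no ¬ps with m≤n⇒m<n∨m≡n s≤d
...   | inj₁ s<d = searchOrd≢0 m fuel (suc s) d (m≤n⇒m≤1+n 1≤s) s<d (subst (d <_) (+-suc s fuel) d<) per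
...   | inj₂ refl = contradiction per ¬ps

does≡true⇒ : ∀ {A : Set} (a? : Dec A) → does a? ≡ true → A
does≡true⇒ (yes a) _ = a

allBelow-complete : ∀ n P → (∀ t → t < n → P t ≡ true) → allBelow n P ≡ true
allBelow-complete zero P all = refl
allBelow-complete (suc n) P all
  rewrite allBelow-complete n P (λ t t<n → all t (m≤n⇒m≤1+n t<n)) | all n ≤-refl = refl

allBelow-sound : ∀ n P → allBelow n P ≡ true → ∀ t → t < n → P t ≡ true
allBelow-sound (suc n) P eq t t<1+n with allBelow n P in below | P n in last
... | true | true with m≤n⇒m<n∨m≡n (s≤s⁻¹ t<1+n)
...   | inj₁ t<n = allBelow-sound n P below t t<n
...   | inj₂ refl = last
allBelow-sound (suc n) P () t t<1+n | true | false
allBelow-sound (suc n) P () t t<1+n | false | _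

countIn-suc-true : ∀ n P → P (suc n) ≡ true → countIn (suc n) P ≡ suc (countIn n P)
countIn-suc-true n P eq with P (suc n)
countIn-suc-true n P refl | .true = refl

countIn-mono-≤ : ∀ P {a b} → a ≤ b → countIn a P ≤ countIn b P
countIn-mono-≤ P {a} {zero} z≤n = ≤-refl
countIn-mono-≤ P {a} {suc b} a≤1+b with m≤n⇒m<n∨m≡n a≤1+b
... | inj₂ refl = ≤-refl
... | inj₁ a<1+b = ≤-trans (countIn-mono-≤ P (s≤s⁻¹ a<1+b)) step
  where
  step : countIn b P ≤ countIn (suc b) P
  step with P (suc b)
  ... | true  = n≤1+n _
  ... | false = ≤-refl

-- countIn n P counts the x ∈ [1, n] (not [0, n)) satisfying P, so rank P y
-- counts those in [1, y).
rank : (ℕ → Bool) → ℕ → ℕ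
rank P y = countIn (y ∸ 1) P

rank<countIn : ∀ n P y → 1 ≤ y → y ≤ n → P y ≡ true → rank P y < countIn n P
rank<countIn n P (suc y) _ y<n Py =
  ≤-trans (≤-reflexive (sym (countIn-suc-true y P Py))) (countIn-mono-≤ P y<n)

rank-strictMono : ∀ P {y y′} → 1 ≤ y → y < y′ → P y ≡ true → rank P y < rank P y′
rank-strictMono P {suc y} {suc y′} _ y<y′ Py =
  ≤-trans (≤-reflexive (sym (countIn-suc-true y P Py))) (countIn-mono-≤ P (s≤s⁻¹ y<y′))

rank-injective : ∀ P {y y′} → 1 ≤ y → 1 ≤ y′ → P y ≡ true → P y′ ≡ true →
                 rank P y ≡ rank P y′ → y ≡ y′
rank-injective P {y} {y′} 1≤y 1≤y′ Py Py′ eq with <-cmp y y′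
... | tri< y<y′ _ _ = contradiction eq (<⇒≢ (rank-strictMono P 1≤y y<y′ Py))
... | tri≈ _ y≡y′ _ = y≡y′
... | tri> _ _ y>y′ = contradiction (sym eq) (<⇒≢ (rank-strictMono P 1≤y′ y>y′ Py′))

select : ℕ → (ℕ → Bool) → ℕ → ℕ
select zero P i = 0
select (suc n) P i with P (suc n) | countIn n P ≟ i
... | true | yes _ = suc n
... | _    | _     = select n P i

record Selected (n : ℕ) (P : ℕ → Bool) (i y : ℕ) : Set where
  field
    positive : 1 ≤ y
    bounded  : y ≤ n
    holds    : P y ≡ true
    ranked   : rank P y ≡ i

Selected-widen : ∀ {n P i y} → Selected n P i y → Selected (suc n) P i y
Selected-widen s = record { Selected s ; bounded = m≤n⇒m≤1+n (Selected.bounded s) }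

select-selects : ∀ n P i → i < countIn n P → Selected n P i (select n P i)
select-selects (suc n) P i i< with P (suc n) in Pn | countIn n P ≟ i
... | true | yes ranked =
  record { positive = s≤s z≤n ; bounded = ≤-refl ; holds = Pn ; ranked = ranked }
... | true | no ≢i = Selected-widen (select-selects n P i (≤∧≢⇒< (s≤s⁻¹ i<) (≢i ∘ sym)))
... | false | _ = Selected-widen (select-selects n P i i<)

-- Pigeonhole and minimisation on initial segments of ℕ

injectiveOn⇒≤ : ∀ a b (f : ℕ → ℕ) → (∀ i → i < a → f i < b) →
                (∀ i j → i < a → j < a → f i ≡ f j → i ≡ j) → a ≤ b
injectiveOn⇒≤ a b f f< inj = injective⇒≤ {f = F} F-injective
  where
  F : Fin a → Fin b
  F i = fromℕ< (f< (toℕ i) (toℕ<n i))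
  F-injective : ∀ {i j} → F i ≡ F j → i ≡ j
  F-injective {i} {j} eq = toℕ-injective (inj (toℕ i) (toℕ j) (toℕ<n i) (toℕ<n j) (begin
    f (toℕ i)  ≡⟨ toℕ-fromℕ< _ ⟨
    toℕ (F i)  ≡⟨ cong toℕ eq ⟩
    toℕ (F j)  ≡⟨ toℕ-fromℕ< _ ⟩
    f (toℕ j)  ∎))
    where open ≡-Reasoning

injectiveOn-missing⇒< : ∀ a b (f : ℕ → ℕ) {c} → c < b → (∀ i → i < a → f i ≢ c) →
                       (∀ i → i < a → f i < b) →
                       (∀ i j → i < a → j < a → f i ≡ f j → i ≡ j) → a < b
injectiveOn-missing⇒< a b f {c} c<b missing f< inj = injectiveOn⇒≤ (suc a) b g g< g-injective
  where
  g : ℕ → ℕ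
  g zero    = c
  g (suc i) = f i
  g< : ∀ i → i < suc a → g i < b
  g< zero    _       = c<b
  g< (suc i) 1+i<1+a = f< i (s≤s⁻¹ 1+i<1+a)
  g-injective : ∀ i j → i < suc a → j < suc a → g i ≡ g j → i ≡ j
  g-injective zero    zero    _     _     _  = refl
  g-injective zero    (suc j) _     1+j<  eq = contradiction (sym eq) (missing j (s≤s⁻¹ 1+j<))
  g-injective (suc i) zero    1+i<  _     eq = contradiction eq (missing i (s≤s⁻¹ 1+i<))
  g-injective (suc i) (suc j) 1+i<  1+j<  eq = cong suc (inj i j (s≤s⁻¹ 1+i<) (s≤s⁻¹ 1+j<) eq)

argmin : (ℕ → ℕ) → ℕ → ℕ
argmin f zero = 0
argmin f (suc k) with f (suc k) <? f (argmin f k)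
... | yes _ = suc k
... | no  _ = argmin f k

argmin≤ : ∀ (f : ℕ → ℕ) k → argmin f k ≤ k
argmin≤ f zero = z≤n
argmin≤ f (suc k) with f (suc k) <? f (argmin f k)
... | yes _ = ≤-refl
... | no  _ = m≤n⇒m≤1+n (argmin≤ f k)

argmin-minimal : ∀ (f : ℕ → ℕ) k j → j ≤ k → f (argmin f k) ≤ f j
argmin-minimal f zero zero _ = ≤-refl
argmin-minimal f (suc k) j j≤1+k with f (suc k) <? f (argmin f k) | m≤n⇒m<n∨m≡n j≤1+k
... | yes lt  | inj₁ j<1+k = ≤-trans (<⇒≤ lt) (argmin-minimal f k j (s≤s⁻¹ j<1+k))
... | yes _   | inj₂ refl  = ≤-refl
... | no  _   | inj₁ j<1+k = argmin-minimal f k j (s≤s⁻¹ j<1+k)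
... | no  ¬lt | inj₂ refl  = ≮⇒≥ ¬lt

mod≡% : ∀ a m .{{_ : NonZero m}} → a mod m ≡ a % m
mod≡% a (suc m) = refl

%≡%⇒∣∸ : ∀ u v m .{{_ : NonZero m}} → u % m ≡ v % m → m ∣ u ∸ v
%≡%⇒∣∸ u v m eq = divides (u / m ∸ v / m) (begin
  u ∸ v                                    ≡⟨ cong₂ _∸_ (m≡m%n+[m/n]*n u m) (m≡m%n+[m/n]*n v m) ⟩
  (u % m + u / m * m) ∸ (v % m + v / m * m) ≡⟨ cong (λ z → (z + u / m * m) ∸ (v % m + v / m * m)) eq ⟩
  (v % m + u / m * m) ∸ (v % m + v / m * m) ≡⟨ [m+n]∸[m+o]≡n∸o (v % m) _ _ ⟩
  u / m * m ∸ v / m * m                    ≡⟨ *-distribʳ-∸ m (u / m) (v / m) ⟨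
  (u / m ∸ v / m) * m                      ∎)
  where open ≡-Reasoning

∣∸⇒%≡% : ∀ u v m .{{_ : NonZero m}} → v ≤ u → m ∣ u ∸ v → u % m ≡ v % m
∣∸⇒%≡% u v m v≤u m∣u∸v = begin
  u % m            ≡⟨ cong (_% m) (m+[n∸m]≡n v≤u) ⟨
  (v + (u ∸ v)) % m ≡⟨ %-remove-+ʳ v m∣u∸v ⟩
  v % m            ∎
  where open ≡-Reasoning

[m%d*n]%d≡[m*n]%d : ∀ m n d .{{_ : NonZero d}} → (m % d * n) % d ≡ (m * n) % d
[m%d*n]%d≡[m*n]%d m n d = begin
  (m % d * n) % d           ≡⟨ %-distribˡ-* (m % d) n d ⟩
  (m % d % d * (n % d)) % d ≡⟨ cong (λ z → (z * (n % d)) % d) (m%n%n≡m%n m d) ⟩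
  (m % d * (n % d)) % d     ≡⟨ %-distribˡ-* m n d ⟨
  (m * n) % d               ∎
  where open ≡-Reasoning

[m+n%d]%d≡[m+n]%d : ∀ m n d .{{_ : NonZero d}} → (m + n % d) % d ≡ (m + n) % d
[m+n%d]%d≡[m+n]%d m n d = begin
  (m + n % d) % d         ≡⟨ %-distribˡ-+ m (n % d) d ⟩
  (m % d + n % d % d) % d ≡⟨ cong (λ z → (m % d + z) % d) (m%n%n≡m%n n d) ⟩
  (m % d + n % d) % d     ≡⟨ %-distribˡ-+ m n d ⟨
  (m + n) % d             ∎
  where open ≡-Reasoning

odd⇒coprime[2] : ∀ {m} → ¬ 2 ∣ m → Coprime m 2
odd⇒coprime[2] odd {i} (i∣m , i∣2) with prime⇒irreducible prime[2] i∣2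
... | inj₁ i≡1 = i≡1
... | inj₂ refl = contradiction i∣m odd

odd∣2^t*n⇒∣n : ∀ {m} t n → ¬ 2 ∣ m → m ∣ 2 ^ t * n → m ∣ n
odd∣2^t*n⇒∣n {m} zero n odd m∣n = subst (m ∣_) (+-identityʳ n) m∣n
odd∣2^t*n⇒∣n {m} (suc t) n odd m∣2*2^t*n =
  odd∣2^t*n⇒∣n t n odd
    (coprime-divisor (odd⇒coprime[2] odd) (subst (m ∣_) (*-assoc 2 (2 ^ t) n) m∣2*2^t*n))

q*d+j<Q*d : ∀ {q Q j} d → q < Q → j < d → q * d + j < Q * d
q*d+j<Q*d {q} {Q} {j} d q<Q j<d = begin-strict
  q * d + j <⟨ +-monoʳ-< (q * d) j<d ⟩
  q * d + d ≡⟨ +-comm (q * d) d ⟩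
  suc q * d ≤⟨ *-monoˡ-≤ d q<Q ⟩
  Q * d     ∎
  where open ≤-Reasoning

q*d+j-injective : ∀ {q q′ j j′} d .{{_ : NonZero d}} → j < d → j′ < d →
                  q * d + j ≡ q′ * d + j′ → q ≡ q′ × j ≡ j′
q*d+j-injective {q} {q′} {j} {j′} d j<d j′<d eq = q≡q′ , j≡j′
  where
  j≡j′ : j ≡ j′
  j≡j′ = begin
    j                ≡⟨ m<n⇒m%n≡m j<d ⟨
    j % d            ≡⟨ [m+kn]%n≡m%n j q d ⟨
    (j + q * d) % d   ≡⟨ cong (_% d) (trans (+-comm j (q * d)) (trans eq (+-comm (q′ * d) j′))) ⟩
    (j′ + q′ * d) % d ≡⟨ [m+kn]%n≡m%n j′ q′ d ⟩
    j′ % d           ≡⟨ m<n⇒m%n≡m j′<d ⟩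
    j′               ∎
    where open ≡-Reasoning
  q≡q′ : q ≡ q′
  q≡q′ = *-cancelʳ-≡ q q′ d
    (+-cancelʳ-≡ j (q * d) (q′ * d) (trans eq (cong (q′ * d +_) (sym j≡j′))))

module Doubling (m : ℕ) .{{_ : NonZero m}} where

  infixl 7 _·2^_
  _·2^_ : ℕ → ℕ → ℕ
  x ·2^ j = (x * 2 ^ j) % m

  ·2^-+ : ∀ x a b → x ·2^ a ·2^ b ≡ x ·2^ (a + b)
  ·2^-+ x a b = begin
    ((x * 2 ^ a) % m * 2 ^ b) % m ≡⟨ [m%d*n]%d≡[m*n]%d (x * 2 ^ a) (2 ^ b) m ⟩
    (x * 2 ^ a * 2 ^ b) % m       ≡⟨ cong (_% m) (*-assoc x (2 ^ a) (2 ^ b)) ⟩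
    (x * (2 ^ a * 2 ^ b)) % m     ≡⟨ cong (λ z → (x * z) % m) (^-distribˡ-+-* 2 a b) ⟨
    (x * 2 ^ (a + b)) % m         ∎
    where open ≡-Reasoning

  ·2^-zero : ∀ {x} → x < m → x ·2^ 0 ≡ x
  ·2^-zero {x} x<m = trans (cong (_% m) (*-identityʳ x)) (m<n⇒m%n≡m x<m)

  ·2^<m : ∀ x j → x ·2^ j < m
  ·2^<m x j = m%n<n (x * 2 ^ j) m

  private
    ·2^-cancel-≥ : ∀ {a b} t → ¬ 2 ∣ m → a < m → b < m → b ≤ a →
                   a ·2^ t ≡ b ·2^ t → a ≡ b
    ·2^-cancel-≥ {a} {b} t odd a<m b<m b≤a eq = begin
      a     ≡⟨ m<n⇒m%n≡m a<m ⟨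
      a % m ≡⟨ ∣∸⇒%≡% a b m b≤a (odd∣2^t*n⇒∣n t (a ∸ b) odd m∣2^t*[a∸b]) ⟩
      b % m ≡⟨ m<n⇒m%n≡m b<m ⟩
      b     ∎
      where
      open ≡-Reasoning
      m∣2^t*[a∸b] : m ∣ 2 ^ t * (a ∸ b)
      m∣2^t*[a∸b] = subst (m ∣_) (trans (sym (*-distribʳ-∸ (2 ^ t) a b)) (*-comm (a ∸ b) (2 ^ t)))
                      (%≡%⇒∣∸ (a * 2 ^ t) (b * 2 ^ t) m eq)

  ·2^-cancel : ∀ {a b} t → ¬ 2 ∣ m → a < m → b < m → a ·2^ t ≡ b ·2^ t → a ≡ b
  ·2^-cancel {a} {b} t odd a<m b<m eq with ≤-total b a
  ... | inj₁ b≤a = ·2^-cancel-≥ t odd a<m b<m b≤a eq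
  ... | inj₂ a≤b = sym (·2^-cancel-≥ t odd b<m a<m a≤b (sym eq))

  ·2^≢0 : ∀ {x} j → ¬ 2 ∣ m → 1 ≤ x → x < m → x ·2^ j ≢ 0
  ·2^≢0 {x} j odd 1≤x x<m eq = contradiction (subst (1 ≤_) x≡0 1≤x) λ ()
    where
    0<m : 0 < m
    0<m = >-nonZero⁻¹ m
    x≡0 : x ≡ 0
    x≡0 = ·2^-cancel j odd x<m 0<m (trans eq (sym (m<n⇒m%n≡m 0<m)))

  private
    x*[2^t∸1]≡x*2^t∸x : ∀ x t → x * (2 ^ t ∸ 1) ≡ x * 2 ^ t ∸ x
    x*[2^t∸1]≡x*2^t∸x x t = trans (*-distribˡ-∸ x (2 ^ t) 1) (cong (x * 2 ^ t ∸_) (*-identityʳ x))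

  ·2^-fixed⇒∣ : ∀ {x} t → x < m → x ·2^ t ≡ x → m ∣ x * (2 ^ t ∸ 1)
  ·2^-fixed⇒∣ {x} t x<m fixed = subst (m ∣_) (sym (x*[2^t∸1]≡x*2^t∸x x t))
    (%≡%⇒∣∸ (x * 2 ^ t) x m (trans fixed (sym (m<n⇒m%n≡m x<m))))

  ∣⇒·2^-fixed : ∀ {x} t → x < m → m ∣ x * (2 ^ t ∸ 1) → x ·2^ t ≡ x
  ∣⇒·2^-fixed {x} t x<m m∣ = trans
    (∣∸⇒%≡% (x * 2 ^ t) x m (m≤m*n x (2 ^ t) {{m^n≢0 2 t}})
      (subst (m ∣_) (x*[2^t∸1]≡x*2^t∸x x t) m∣))
    (m<n⇒m%n≡m x<m)

  module Periodic (D : ℕ) (per : Period m D) where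

    ·2^-period : ∀ x a → x ·2^ (a + D) ≡ x ·2^ a
    ·2^-period x a = begin
      x ·2^ (a + D)  ≡⟨ ·2^-+ x a D ⟨
      x ·2^ a ·2^ D  ≡⟨ ∣⇒·2^-fixed D (·2^<m x a) (∣n⇒∣m*n (x ·2^ a) per) ⟩
      x ·2^ a        ∎
      where open ≡-Reasoning

    ·2^-periods : ∀ x a k → x ·2^ (a + k * D) ≡ x ·2^ a
    ·2^-periods x a zero = cong (x ·2^_) (+-identityʳ a)
    ·2^-periods x a (suc k) = begin
      x ·2^ (a + (D + k * D)) ≡⟨ cong (λ d → x ·2^ (a + d)) (+-comm D (k * D)) ⟩
      x ·2^ (a + (k * D + D)) ≡⟨ cong (x ·2^_) (+-assoc a (k * D) D) ⟨
      x ·2^ (a + k * D + D)   ≡⟨ ·2^-period x (a + k * D) ⟩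
      x ·2^ (a + k * D)       ≡⟨ ·2^-periods x a k ⟩
      x ·2^ a                 ∎
      where open ≡-Reasoning

    ·2^-%period : .{{_ : NonZero D}} → ∀ x a → x ·2^ a ≡ x ·2^ (a % D)
    ·2^-%period x a = trans (cong (x ·2^_) (m≡m%n+[m/n]*n a D)) (·2^-periods x (a % D) (a / D))

-- The order of 2

h-isOrder : ∀ {m} → h m ≢ 0 → IsOrder m (h m)
h-isOrder {m} = searchOrd-sound m m 1

h≡order : ∀ {m e} → IsOrder m e → e ≤ m → h m ≡ e
h≡order {m} {e} ord e≤m = searchOrd-finds m m 1 e ord (s≤s e≤m)

order≤ : ∀ {m e} .{{_ : NonZero m}} → ¬ 2 ∣ m → 1 < m → IsOrder m e → e ≤ m
order≤ {m} {e} odd 1<m ord = injectiveOn⇒≤ e m (1 ·2^_) (λ i _ → ·2^<m 1 i) injective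
  where
  open Doubling m
  open LeastPeriodFrom ord
  injective-≤ : ∀ i j → i ≤ j → j < e → 1 ·2^ i ≡ 1 ·2^ j → i ≡ j
  injective-≤ i j i≤j j<e eq with j ∸ i in j∸i≡t
  ... | zero = ≤-antisym i≤j (m∸n≡0⇒m≤n j∸i≡t)
  ... | suc t = contradiction period[1+t] (least (suc t) (s≤s z≤n) 1+t<e)
    where
    1+t<e : suc t < e
    1+t<e = subst (_< e) j∸i≡t (≤-<-trans (m∸n≤m j i) j<e)
    1·2^[1+t]·2^i≡1·2^i : 1 ·2^ suc t ·2^ i ≡ 1 ·2^ i
    1·2^[1+t]·2^i≡1·2^i = begin
      1 ·2^ suc t ·2^ i   ≡⟨ ·2^-+ 1 (suc t) i ⟩
      1 ·2^ (suc t + i)   ≡⟨ cong (λ d → 1 ·2^ (d + i)) j∸i≡t ⟨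
      1 ·2^ (j ∸ i + i)   ≡⟨ cong (1 ·2^_) (m∸n+n≡m i≤j) ⟩
      1 ·2^ j             ≡⟨ eq ⟨
      1 ·2^ i             ∎
      where open ≡-Reasoning
    period[1+t] : Period m (suc t)
    period[1+t] = subst (m ∣_) (*-identityˡ _)
      (·2^-fixed⇒∣ (suc t) 1<m (·2^-cancel i odd (·2^<m 1 (suc t)) 1<m 1·2^[1+t]·2^i≡1·2^i))
  injective : ∀ i j → i < e → j < e → 1 ·2^ i ≡ 1 ·2^ j → i ≡ j
  injective i j i<e j<e eq with ≤-total i j
  ... | inj₁ i≤j = injective-≤ i j i≤j j<e eq
  ... | inj₂ j≤i = sym (injective-≤ j i j≤i i<e (sym eq))

h-isOrder-of-period : ∀ {m D} .{{_ : NonZero m}} → ¬ 2 ∣ m → 1 < m → 1 ≤ D → Period m D →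
                      IsOrder m (h m)
h-isOrder-of-period {m} {D} odd 1<m 1≤D per = subst (IsOrder m) (sym h≡e) ord
  where
  ord : IsOrder m (searchOrd m D 1)
  ord = searchOrd-sound m D 1 (searchOrd≢0 m D 1 D ≤-refl 1≤D ≤-refl per)
  h≡e : h m ≡ searchOrd m D 1
  h≡e = h≡order ord (order≤ odd 1<m ord)

-- Counting cyclotomic cosets

module Cosets (m : ℕ) .{{_ : NonZero m}} (odd : ¬ 2 ∣ m)
              (D : ℕ) .{{_ : NonZero D}} (per : Period m D) (h≡D : h m ≡ D) where

  open Doubling m
  open Periodic D per

  IsLeader : ℕ → Set
  IsLeader y = isCosetLeader m y ≡ true

  private
    ≤·2^? : ℕ → ℕ → Bool
    ≤·2^? y j = does (y ≤? ((y * 2 ^ j) mod m))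

  isLeader⇒minimal : ∀ {y} → IsLeader y → ∀ t → t < D → y ≤ y ·2^ t
  isLeader⇒minimal {y} isL t t<D = subst (y ≤_) (mod≡% (y * 2 ^ t) m)
    (does≡true⇒ (y ≤? _) (allBelow-sound (h m) (≤·2^? y) isL t (subst (t <_) (sym h≡D) t<D)))

  minimal⇒isLeader : ∀ {y} → (∀ t → t < D → y ≤ y ·2^ t) → IsLeader y
  minimal⇒isLeader {y} minimal = allBelow-complete (h m) (≤·2^? y) λ t t<h →
    dec-true (y ≤? _) (subst (y ≤_) (sym (mod≡% (y * 2 ^ t) m)) (minimal t (subst (t <_) h≡D t<h)))

  ·2^-undo : ∀ {x} t → t ≤ D → x < m → x ·2^ t ·2^ ((D ∸ t) % D) ≡ x
  ·2^-undo {x} t t≤D x<m = begin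
    x ·2^ t ·2^ ((D ∸ t) % D)         ≡⟨ ·2^-+ x t _ ⟩
    x ·2^ (t + (D ∸ t) % D)           ≡⟨ ·2^-%period x _ ⟩
    x ·2^ ((t + (D ∸ t) % D) % D)     ≡⟨ cong (x ·2^_) ([m+n%d]%d≡[m+n]%d t (D ∸ t) D) ⟩
    x ·2^ ((t + (D ∸ t)) % D)         ≡⟨ cong (λ d → x ·2^ (d % D)) (m+[n∸m]≡n t≤D) ⟩
    x ·2^ (D % D)                     ≡⟨ cong (x ·2^_) (n%n≡0 D) ⟩
    x ·2^ 0                           ≡⟨ ·2^-zero x<m ⟩
    x                                 ∎
    where open ≡-Reasoning

  leader-unique : ∀ {L L′ t} → IsLeader L → IsLeader L′ → L′ < m → t < D →
                  L ≡ L′ ·2^ t → L ≡ L′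
  leader-unique {L} {L′} {t} isL isL′ L′<m t<D L≡L′·2^t = ≤-antisym L≤L′ L′≤L
    where
    L′≤L : L′ ≤ L
    L′≤L = subst (L′ ≤_) (sym L≡L′·2^t) (isLeader⇒minimal isL′ t t<D)
    L·2^[D∸t]≡L′ : L ·2^ ((D ∸ t) % D) ≡ L′
    L·2^[D∸t]≡L′ = trans (cong (_·2^ ((D ∸ t) % D)) L≡L′·2^t) (·2^-undo t (<⇒≤ t<D) L′<m)
    L≤L′ : L ≤ L′
    L≤L′ = subst (L ≤_) L·2^[D∸t]≡L′ (isLeader⇒minimal isL _ (m%n<n (D ∸ t) D))

  leaderShift : ℕ → ℕ
  leaderShift x = argmin (x ·2^_) (pred D)

  leaderShift<D : ∀ x → leaderShift x < D
  leaderShift<D x = ≤-<-trans (argmin≤ (x ·2^_) (pred D)) (m≤pred[n]⇒suc[m]≤n ≤-refl)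

  leader : ℕ → ℕ
  leader x = x ·2^ leaderShift x

  unshift : ℕ → ℕ
  unshift x = (D ∸ leaderShift x) % D

  unshift<D : ∀ x → unshift x < D
  unshift<D x = m%n<n (D ∸ leaderShift x) D

  leader·2^unshift : ∀ {x} → x < m → leader x ·2^ unshift x ≡ x
  leader·2^unshift {x} x<m = ·2^-undo (leaderShift x) (<⇒≤ (leaderShift<D x)) x<m

  leader-minimal : ∀ x j → j < D → leader x ≤ x ·2^ j
  leader-minimal x j j<D = argmin-minimal (x ·2^_) (pred D) j (<⇒≤pred j<D)

  leader-isLeader : ∀ x → IsLeader (leader x)
  leader-isLeader x = minimal⇒isLeader λ t _ →
    subst (leader x ≤_) (sym (shifted t)) (leader-minimal x _ (m%n<n (leaderShift x + t) D))
    where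
    shifted : ∀ t → leader x ·2^ t ≡ x ·2^ ((leaderShift x + t) % D)
    shifted t = trans (·2^-+ x (leaderShift x) t) (·2^-%period x (leaderShift x + t))

  leader-positive : ∀ {x} → 1 ≤ x → x < m → 1 ≤ leader x
  leader-positive {x} 1≤x x<m = n≢0⇒n>0 (·2^≢0 (leaderShift x) odd 1≤x x<m)

  leader<m : ∀ x → leader x < m
  leader<m x = ·2^<m x (leaderShift x)

  leaderRank : ℕ → ℕ
  leaderRank = rank (isCosetLeader m)

  codeOf : ℕ → ℕ → ℕ
  codeOf L j = leaderRank L * D + j

  codeOf<r*D : ∀ {L j} → IsLeader L → 1 ≤ L → L < m → j < D → codeOf L j < r m * D
  codeOf<r*D {L} isL 1≤L L<m j<D =
    q*d+j<Q*d D (rank<countIn (pred m) (isCosetLeader m) L 1≤L (<⇒≤pred L<m) isL) j<D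

  codeOf-injective : ∀ {L L′ j j′} → IsLeader L → IsLeader L′ → 1 ≤ L → 1 ≤ L′ →
                     j < D → j′ < D → codeOf L j ≡ codeOf L′ j′ → L ≡ L′ × j ≡ j′
  codeOf-injective isL isL′ 1≤L 1≤L′ j<D j′<D eq with q*d+j-injective D j<D j′<D eq
  ... | rank≡ , j≡j′ = rank-injective (isCosetLeader m) 1≤L 1≤L′ isL isL′ rank≡ , j≡j′

  code : ℕ → ℕ
  code x = codeOf (leader x) (unshift x)

  code<r*D : ∀ {x} → 1 ≤ x → x < m → code x < r m * D
  code<r*D {x} 1≤x x<m =
    codeOf<r*D (leader-isLeader x) (leader-positive 1≤x x<m) (leader<m x) (unshift<D x)

  codeOf≡code⇒ : ∀ {L j y} → IsLeader L → 1 ≤ L → j < D → 1 ≤ y → y < m →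
                 codeOf L j ≡ code y → L ·2^ j ≡ y × j ≡ unshift y
  codeOf≡code⇒ {L} {j} {y} isL 1≤L j<D 1≤y y<m eq
    with codeOf-injective isL (leader-isLeader y) 1≤L (leader-positive 1≤y y<m) j<D (unshift<D y) eq
  ... | L≡leader , j≡unshift =
    trans (cong₂ _·2^_ L≡leader j≡unshift) (leader·2^unshift y<m) , j≡unshift

  code-injective : ∀ {x x′} → 1 ≤ x → x < m → 1 ≤ x′ → x′ < m →
                   code x ≡ code x′ → x ≡ x′
  code-injective {x} 1≤x x<m 1≤x′ x′<m eq = trans (sym (leader·2^unshift x<m))
    (proj₁ (codeOf≡code⇒ (leader-isLeader x) (leader-positive 1≤x x<m) (unshift<D x) 1≤x′ x′<m eq))

  private
    code∘suc< : ∀ i → i < pred m → code (suc i) < r m * D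
    code∘suc< i i<m∸1 = code<r*D (s≤s z≤n) (m≤pred[n]⇒suc[m]≤n i<m∸1)

    code∘suc-injective : ∀ i j → i < pred m → j < pred m → code (suc i) ≡ code (suc j) → i ≡ j
    code∘suc-injective i j i<m∸1 j<m∸1 eq = suc-injective
      (code-injective (s≤s z≤n) (m≤pred[n]⇒suc[m]≤n i<m∸1)
                      (s≤s z≤n) (m≤pred[n]⇒suc[m]≤n j<m∸1) eq)

  m∸1≤r*D : pred m ≤ r m * D
  m∸1≤r*D = injectiveOn⇒≤ (pred m) (r m * D) (code ∘ suc) code∘suc< code∘suc-injective

  -- A short coset leaves a code unused: shifting the leader of x₀ by
  -- unshift x₀ + H also reaches x₀, but its code is not the code of any element.
  shortCoset⇒m∸1<r*D : ∀ {x₀ H} → 1 ≤ x₀ → x₀ < m → 0 < H → H < D → x₀ ·2^ H ≡ x₀ →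
                       pred m < r m * D
  shortCoset⇒m∸1<r*D {x₀} {H} 1≤x₀ x₀<m 0<H H<D fixed =
    injectiveOn-missing⇒< (pred m) (r m * D) (code ∘ suc)
      (codeOf<r*D (leader-isLeader x₀) (leader-positive 1≤x₀ x₀<m) (leader<m x₀) j₀<D)
      (λ i i<m∸1 → unused (s≤s z≤n) (m≤pred[n]⇒suc[m]≤n i<m∸1) ∘ sym)
      code∘suc< code∘suc-injective
    where
    j₀ : ℕ
    j₀ = (unshift x₀ + H) % D
    j₀<D : j₀ < D
    j₀<D = m%n<n (unshift x₀ + H) D
    leader·2^j₀ : leader x₀ ·2^ j₀ ≡ x₀
    leader·2^j₀ = begin
      leader x₀ ·2^ ((unshift x₀ + H) % D) ≡⟨ ·2^-%period (leader x₀) _ ⟨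
      leader x₀ ·2^ (unshift x₀ + H)       ≡⟨ ·2^-+ (leader x₀) (unshift x₀) H ⟨
      leader x₀ ·2^ unshift x₀ ·2^ H       ≡⟨ cong (_·2^ H) (leader·2^unshift x₀<m) ⟩
      x₀ ·2^ H                            ≡⟨ fixed ⟩
      x₀                                  ∎
      where open ≡-Reasoning
    j₀≢unshift : j₀ ≢ unshift x₀
    j₀≢unshift eq = <⇒≱ H<D (∣⇒≤ {{>-nonZero 0<H}} D∣H)
      where
      D∣H : D ∣ H
      D∣H = subst (D ∣_) (m+n∸m≡n (unshift x₀) H)
              (%≡%⇒∣∸ (unshift x₀ + H) (unshift x₀) D (trans eq (sym (m<n⇒m%n≡m (unshift<D x₀)))))
    unused : ∀ {y} → 1 ≤ y → y < m → codeOf (leader x₀) j₀ ≢ code y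
    unused {y} 1≤y y<m eq
      with codeOf≡code⇒ (leader-isLeader x₀) (leader-positive 1≤x₀ x₀<m) j₀<D 1≤y y<m eq
    ... | reaches-y , j₀≡unshift = j₀≢unshift (trans j₀≡unshift (cong unshift y≡x₀))
      where
      y≡x₀ : y ≡ x₀
      y≡x₀ = trans (sym reaches-y) leader·2^j₀

  FullCosets : Set
  FullCosets = ∀ {x t} → 1 ≤ x → x < m → 0 < t → t < D → x ·2^ t ≢ x

  module _ (full : FullCosets) where

    private
      leader·2^-injective-≤ : ∀ {L L′ j j′} → IsLeader L → IsLeader L′ →
                              L < m → 1 ≤ L′ → L′ < m → j ≤ j′ → j′ < D → L ·2^ j ≡ L′ ·2^ j′ → L ≡ L′ × j ≡ j′
      leader·2^-injective-≤ {L} {L′} {j} {j′} isL isL′ L<m 1≤L′ L′<m j≤j′ j′<D eq = L≡L′ , j≡j′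
        where
        t : ℕ
        t = j′ ∸ j
        t<D : t < D
        t<D = ≤-<-trans (m∸n≤m j′ j) j′<D
        L·2^j≡L′·2^t·2^j : L ·2^ j ≡ L′ ·2^ t ·2^ j
        L·2^j≡L′·2^t·2^j = trans eq (trans (cong (L′ ·2^_) (sym (m∸n+n≡m j≤j′)))
                                           (sym (·2^-+ L′ t j)))
        L≡L′·2^t : L ≡ L′ ·2^ t
        L≡L′·2^t = ·2^-cancel j odd L<m (·2^<m L′ t) L·2^j≡L′·2^t·2^j
        L≡L′ : L ≡ L′
        L≡L′ = leader-unique isL isL′ L′<m t<D L≡L′·2^t
        t≡0 : t ≡ 0
        t≡0 = n≤0⇒n≡0 (≮⇒≥ λ 0<t → full 1≤L′ L′<m 0<t t<D (trans (sym L≡L′·2^t) L≡L′))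
        j≡j′ : j ≡ j′
        j≡j′ = ≤-antisym j≤j′ (m∸n≡0⇒m≤n t≡0)

    leader·2^-injective : ∀ {L L′ j j′} → IsLeader L → IsLeader L′ →
                          1 ≤ L → L < m → 1 ≤ L′ → L′ < m → j < D → j′ < D → L ·2^ j ≡ L′ ·2^ j′ → L ≡ L′ × j ≡ j′
    leader·2^-injective {j = j} {j′} isL isL′ 1≤L L<m 1≤L′ L′<m j<D j′<D eq with ≤-total j j′
    ... | inj₁ j≤j′ = leader·2^-injective-≤ isL isL′ L<m 1≤L′ L′<m j≤j′ j′<D eq
    ... | inj₂ j′≤j with leader·2^-injective-≤ isL′ isL L′<m 1≤L L<m j′≤j j<D (sym eq)
    ...   | L′≡L , j′≡j = sym L′≡L , sym j′≡j

    r*D≤m∸1 : r m * D ≤ pred m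
    r*D≤m∸1 = injectiveOn⇒≤ (r m * D) (pred m) (pred ∘ element) element∸1<m∸1 injective
      where
      representative : ℕ → ℕ
      representative i = select (pred m) (isCosetLeader m) (i / D)
      element : ℕ → ℕ
      element i = representative i ·2^ (i % D)
      selected : ∀ {i} → i < r m * D → Selected (pred m) (isCosetLeader m) (i / D) (representative i)
      selected i< = select-selects (pred m) (isCosetLeader m) _ (m<n*o⇒m/o<n i<)
      representative<m : ∀ {i} → i < r m * D → representative i < m
      representative<m i< = m≤pred[n]⇒suc[m]≤n (Selected.bounded (selected i<))
      element-positive : ∀ {i} → i < r m * D → 1 ≤ element i
      element-positive {i} i< =
        n≢0⇒n>0 (·2^≢0 (i % D) odd (Selected.positive (selected i<)) (representative<m i<))
      element∸1<m∸1 : ∀ i → i < r m * D → pred (element i) < pred m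
      element∸1<m∸1 i i< = ∸-monoˡ-< (·2^<m (representative i) (i % D)) (element-positive i<)
      injective : ∀ i j → i < r m * D → j < r m * D → pred (element i) ≡ pred (element j) → i ≡ j
      injective i j i< j< eq
        with leader·2^-injective (Selected.holds (selected i<)) (Selected.holds (selected j<))
               (Selected.positive (selected i<)) (representative<m i<)
               (Selected.positive (selected j<)) (representative<m j<)
               (m%n<n i D) (m%n<n j D) (∸-cancelʳ-≡ (element-positive i<) (element-positive j<) eq)
      ... | representative≡ , i%D≡j%D = begin
        i                 ≡⟨ m≡m%n+[m/n]*n i D ⟩
        i % D + i / D * D ≡⟨ cong₂ (λ a b → a + b * D) i%D≡j%D i/D≡j/D ⟩
        j % D + j / D * D ≡⟨ m≡m%n+[m/n]*n j D ⟨
        j                 ∎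
        where
        open ≡-Reasoning
        i/D≡j/D : i / D ≡ j / D
        i/D≡j/D = trans (sym (Selected.ranked (selected i<)))
                    (trans (cong leaderRank representative≡) (Selected.ranked (selected j<)))

    r*D≡m∸1 : r m * D ≡ pred m
    r*D≡m∸1 = ≤-antisym r*D≤m∸1 m∸1≤r*D

prime∣^⇒∣ : ∀ {p} q e → Prime p → p ∣ q ^ e → p ∣ q
prime∣^⇒∣ q zero    prime-p p∣1 = contradiction (subst Prime (∣1⇒≡1 p∣1) prime-p) ¬prime[1]
prime∣^⇒∣ q (suc e) prime-p p∣q*q^e with euclidsLemma q (q ^ e) prime-p p∣q*q^e
... | inj₁ p∣q   = p∣q
... | inj₂ p∣q^e = prime∣^⇒∣ q e prime-p p∣q^e

prime∣prime⇒≡ : ∀ {p q} → Prime p → Prime q → p ∣ q → p ≡ q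
prime∣prime⇒≡ prime-p prime-q p∣q with prime⇒irreducible prime-q p∣q
... | inj₁ refl = contradiction prime-p ¬prime[1]
... | inj₂ p≡q  = p≡q

prime^∣*⇒∣ : ∀ {p} e x c → Prime p → p ^ e ∣ x * c → ¬ p ∣ c → p ^ e ∣ x
prime^∣*⇒∣ zero x c prime-p _ _ = 1∣ x
prime^∣*⇒∣ {p} (suc e) x c prime-p p*p^e∣x*c p∤c
  with euclidsLemma x c prime-p (∣-trans (m∣m*n (p ^ e)) p*p^e∣x*c)
... | inj₂ p∣c = contradiction p∣c p∤c
... | inj₁ (divides x′ refl) = subst (p * p ^ e ∣_) (*-comm p x′) (*-monoʳ-∣ p p^e∣x′)
  where
  instance
    _ = prime⇒nonZero prime-p
  p^e∣x′ : p ^ e ∣ x′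
  p^e∣x′ = prime^∣*⇒∣ e x′ c prime-p
    (*-cancelˡ-∣ p (subst (p * p ^ e ∣_) (trans (cong (_* c) (*-comm x′ p)) (*-assoc p x′ c))
                          p*p^e∣x*c))
    p∤c

f∣∏ : ∀ k (f : Fin k → ℕ) i → f i ∣ ∏ k f
f∣∏ (suc k) f zero    = m∣m*n (∏ k (f ∘ suc))
f∣∏ (suc k) f (suc i) = ∣n⇒∣m*n (f zero) (f∣∏ k (f ∘ suc) i)

∏-odd : ∀ k (f : Fin k → ℕ) → (∀ i → ¬ 2 ∣ f i) → ¬ 2 ∣ ∏ k f
∏-odd zero    f odd 2∣1 = contradiction (∣1⇒≡1 2∣1) λ ()
∏-odd (suc k) f odd 2∣∏ with euclidsLemma (f zero) (∏ k (f ∘ suc)) prime[2] 2∣∏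
... | inj₁ 2∣f₀ = odd zero 2∣f₀
... | inj₂ 2∣∏′ = ∏-odd k (f ∘ suc) (odd ∘ suc) 2∣∏′

∏-positive : ∀ k (f : Fin k → ℕ) → (∀ i → 1 ≤ f i) → 1 ≤ ∏ k f
∏-positive zero    f positive = s≤s z≤n
∏-positive (suc k) f positive = *-mono-≤ (positive zero) (∏-positive k (f ∘ suc) (positive ∘ suc))

∏-primePowers-∣ : ∀ k (p l : Fin k → ℕ) {y} → (∀ i → Prime (p i)) → Injective _≡_ _≡_ p →
                  (∀ i → p i ^ l i ∣ y) → ∏ k (λ i → p i ^ l i) ∣ y
∏-primePowers-∣ zero    p l {y} primes injective _ = 1∣ y
∏-primePowers-∣ (suc k) p l primes injective ∣y with ∣y zero
... | divides t refl = subst (∏ (suc k) (λ i → p i ^ l i) ∣_) (*-comm (p zero ^ l zero) t)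
                         (*-monoʳ-∣ (p zero ^ l zero) ∏′∣t)
  where
  pᵢ∤p₀^l₀ : ∀ i → ¬ p (suc i) ∣ p zero ^ l zero
  pᵢ∤p₀^l₀ i pᵢ∣p₀^l₀ with injective (prime∣prime⇒≡ (primes (suc i)) (primes zero)
                                         (prime∣^⇒∣ (p zero) (l zero) (primes (suc i)) pᵢ∣p₀^l₀))
  ... | ()
  ∏′∣t : ∏ k (λ i → p (suc i) ^ l (suc i)) ∣ t
  ∏′∣t = ∏-primePowers-∣ k (p ∘ suc) (l ∘ suc) (primes ∘ suc) (Fin.suc-injective ∘ injective)
           (λ i → prime^∣*⇒∣ (l (suc i)) t (p zero ^ l zero) (primes (suc i))
                             (∣y (suc i)) (pᵢ∤p₀^l₀ i))

-- Overpseudoprimes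

opsp⇒h≢0 : ∀ {m} → Overpseudoprime2 m → h m ≢ 0
opsp⇒h≢0 {m} (_ , composite-m , m≡r*h+1) h≡0 =
  nonTrivial⇒≢1 {{composite⇒nonTrivial composite-m}} (begin
    m             ≡⟨ m≡r*h+1 ⟩
    r m * h m + 1 ≡⟨ cong (λ d → r m * d + 1) h≡0 ⟩
    r m * 0 + 1   ≡⟨ cong (_+ 1) (*-zeroʳ (r m)) ⟩
    1             ∎)
  where open ≡-Reasoning

h-isOrder-of-multiple : ∀ {d m} .{{_ : NonZero d}} → ¬ 2 ∣ d → 1 < d → d ∣ m → h m ≢ 0 →
                        IsOrder d (h d)
h-isOrder-of-multiple {m = m} odd 1<d d∣m h≢0 = h-isOrder-of-period odd 1<d from (∣-trans d∣m period)
  where open LeastPeriodFrom (h-isOrder {m} h≢0)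

isOrder-of-divisor : ∀ {d m e} → d ∣ m → IsOrder d e → Period m e → IsOrder m e
isOrder-of-divisor d∣m ord per = record
  { from = from ; period = per ; least = λ t 1≤t t<e → least t 1≤t t<e ∘ ∣-trans d∣m }
  where open LeastPeriodFrom ord

opsp-primePower⇒period : ∀ {p l} → Prime p → ¬ 2 ∣ p → 1 ≤ l → Overpseudoprime2 (p ^ l) →
                         Period (p ^ l) (h p)
opsp-primePower⇒period {p} {suc l} prime-p odd _ opsp@(_ , _ , m≡r*D+1) =
  subst (Period m) (≤-antisym D≤H H≤D) (LeastPeriodFrom.period ord-m)
  where
  m D H x₀ : ℕ
  m  = p ^ suc l
  D  = h m
  H  = h p
  x₀ = p ^ l
  1<p : 1 < p
  1<p = nonTrivial⇒n>1 p {{prime⇒nonTrivial prime-p}}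
  ord-m : IsOrder m D
  ord-m = h-isOrder (opsp⇒h≢0 opsp)
  instance
    _ = prime⇒nonZero prime-p
    _ = m^n≢0 p (suc l)
    _ = >-nonZero (LeastPeriodFrom.from ord-m)
  ord-p : IsOrder p H
  ord-p = h-isOrder-of-multiple odd 1<p (m∣m*n x₀) (opsp⇒h≢0 opsp)
  H≤D : H ≤ D
  H≤D = ≮⇒≥ λ D<H → LeastPeriodFrom.least ord-p D (LeastPeriodFrom.from ord-m) D<H
                      (∣-trans (m∣m*n x₀) (LeastPeriodFrom.period ord-m))
  D≤H : D ≤ H
  D≤H = ≮⇒≥ λ H<D →
    <-irrefl m∸1≡r*D (shortCoset⇒m∸1<r*D (m^n>0 p l) x₀<m (LeastPeriodFrom.from ord-p) H<D x₀-fixed)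
    where
    open Doubling m
    open Cosets m (odd ∘ prime∣^⇒∣ p (suc l) prime[2]) D (LeastPeriodFrom.period ord-m) refl
    m∸1≡r*D : pred m ≡ r m * D
    m∸1≡r*D = trans (cong pred m≡r*D+1) (m+n∸n≡m (r m * D) 1)
    x₀<m : x₀ < m
    x₀<m = subst (x₀ <_) (*-comm x₀ p) (m<m*n x₀ p {{m^n≢0 p l}} 1<p)
    x₀-fixed : x₀ ·2^ H ≡ x₀
    x₀-fixed = ∣⇒·2^-fixed H x₀<m (subst (_∣ x₀ * (2 ^ H ∸ 1)) (*-comm x₀ p)
                 (*-monoʳ-∣ x₀ (LeastPeriodFrom.period ord-p)))

m∣m^n : ∀ m {n} → 1 ≤ n → m ∣ m ^ n
m∣m^n m {suc n} _ = m∣m*n (m ^ n)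

module PrimePowerProduct
  (k : ℕ) (p l : Fin (suc k) → ℕ) (primes : ∀ i → Prime (p i)) (odd : ∀ i → ¬ 2 ∣ p i)
  (injective : Injective _≡_ _≡_ p) (1≤l : ∀ i → 1 ≤ l i)
  (opsp : ∀ i → Overpseudoprime2 (p i ^ l i)) (same-h : ∀ i j → h (p i) ≡ h (p j)) where

  n H : ℕ
  n = ∏ (suc k) (λ i → p i ^ l i)
  H = h (p zero)

  pᵢ∣n : ∀ i → p i ∣ n
  pᵢ∣n i = ∣-trans (m∣m^n (p i) (1≤l i)) (f∣∏ (suc k) (λ i → p i ^ l i) i)

  instance
    n≢0 : NonZero n
    n≢0 = >-nonZero (∏-positive (suc k) _ λ i → m^n>0 (p i) {{prime⇒nonZero (primes i)}} (l i))

  1<pᵢ : ∀ i → 1 < p i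
  1<pᵢ i = nonTrivial⇒n>1 (p i) {{prime⇒nonTrivial (primes i)}}

  ord-pᵢ : ∀ i → IsOrder (p i) H
  ord-pᵢ i = subst (IsOrder (p i)) (same-h i zero)
    (h-isOrder-of-multiple {{prime⇒nonZero (primes i)}} (odd i) (1<pᵢ i)
      (m∣m^n (p i) (1≤l i)) (opsp⇒h≢0 (opsp i)))

  instance
    H≢0 : NonZero H
    H≢0 = >-nonZero (LeastPeriodFrom.from (ord-pᵢ zero))

  n-odd : ¬ 2 ∣ n
  n-odd = ∏-odd (suc k) _ λ i → odd i ∘ prime∣^⇒∣ (p i) (l i) prime[2]

  n-period : Period n H
  n-period = ∏-primePowers-∣ (suc k) p l primes injective λ i →
    subst (Period (p i ^ l i)) (same-h i zero) (opsp-primePower⇒period (primes i) (odd i) (1≤l i) (opsp i))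

  h[n]≡H : h n ≡ H
  h[n]≡H = h≡order (isOrder-of-divisor (pᵢ∣n zero) (ord-pᵢ zero) n-period) (begin
    H      ≤⟨ order≤ {{prime⇒nonZero (primes zero)}} (odd zero) (1<pᵢ zero) (ord-pᵢ zero) ⟩
    p zero ≤⟨ ∣⇒≤ (pᵢ∣n zero) ⟩
    n      ∎)
    where open ≤-Reasoning

  open Doubling n
  open Cosets n n-odd H n-period h[n]≡H

  n-fullCosets : FullCosets
  n-fullCosets {x} {t} 1≤x x<n 0<t t<H fixed = <⇒≱ x<n (∣⇒≤ {{>-nonZero 1≤x}} n∣x)
    where
    n∣x : n ∣ x
    n∣x = ∏-primePowers-∣ (suc k) p l primes injective λ i →
      prime^∣*⇒∣ (l i) x (2 ^ t ∸ 1) (primes i)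
        (∣-trans (f∣∏ (suc k) (λ i → p i ^ l i) i) (·2^-fixed⇒∣ t x<n fixed))
        (LeastPeriodFrom.least (ord-pᵢ i) t 0<t t<H)

  n-composite : Composite n
  n-composite = composite-∣ (proj₁ (proj₂ (opsp zero))) (f∣∏ (suc k) (λ i → p i ^ l i) zero)

  n≡r*h+1 : n ≡ r n * h n + 1
  n≡r*h+1 = begin
    n             ≡⟨ m∸n+n≡m (>-nonZero⁻¹ n) ⟨
    pred n + 1    ≡⟨ cong (_+ 1) (r*D≡m∸1 n-fullCosets) ⟨
    r n * H + 1   ≡⟨ cong (λ d → r n * d + 1) h[n]≡H ⟨
    r n * h n + 1 ∎
    where open ≡-Reasoning

theorem3 : (k : ℕ) → 1 ≤ k → (p l : Fin k → ℕ) →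
    (∀ i → Prime (p i)) → (∀ i → ¬ (2 ∣ p i)) → Injective _≡_ _≡_ p →
    (∀ i → 1 ≤ l i) → (∀ i → Overpseudoprime2 (p i ^ l i)) →
    (∀ i j → h (p i) ≡ h (p j)) →
    Overpseudoprime2 (∏ k (λ i → p i ^ l i))
theorem3 (suc k) _ p l primes odd injective 1≤l opsp same-h = n-odd , n-composite , n≡r*h+1
  where open PrimePowerProduct k p l primes odd injective 1≤l opsp same-h
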